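{- Let $U$ be a $\lambda H$-term and let $J=(Y\,G)$ where $Y=(\lambda a\lambda f\,(f\,(a\,a\,f)))\,(\lambda a\lambda f\,(f\,(a\,a\,f)))$ and $G=\lambda x\lambda y\lambda z\,(y\,(x\,z))$. Then $U$ is $J$-$t$-solvable if and only if the $\lambda$-term $U[J/H]$ is solvable.
   Context: $\lambda H$-terms are the $\lambda$-terms built from variables and one additional constant $H$ by abstraction and application; $U[J/H]$ is the result of replacing every occurrence of $H$ by $J$. Application is left-associative. The head reduction step $\rightarrow_t$ is $\lambda\overline{x}\,((\lambda x\,A)\,B)\,W_1\ldots W_n\rightarrow_t\lambda\overline{x}\,A[B/x]\,W_1\ldots W_n$. The $J$-reduction is $\lambda\overline{x}\,H\,U_1U_2U_3\ldots U_n\rightarrow_J\lambda\overline{x}\,U_1\,(H\,U_2)\,U_3\ldots U_n$ for $n\ge2$, and $\lambda\overline{x}\,H\,U_1\rightarrow_J\lambda\overline{x}\,U_1$. A $\lambda H$-term is in head normal form if it has the form $\lambda\overline{x}\,H$ or $\lambda\overline{x}\,x\,V_1\ldots V_n$ with $x$ a variable. A $\lambda H$-term is $J$-$t$-solvable iff some finite sequence of $J$-reduction steps and $t$-reduction steps from it yields a head normal form. A $\lambda$-term is solvable iff its head reduction terminates. -}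

module Defs where

open import Data.Nat using (ℕ; zero; suc)
open import Data.Product using (Σ; _×_; _,_)
open import Data.Sum using (_⊎_)
open import Relation.Nullary using (¬_)
open import Relation.Binary.Construct.Closure.ReflexiveTransitive using (Star)

data Tm : Set where
  var : ℕ → Tm
  H   : Tm
  lam : Tm → Tm
  app : Tm → Tm → Tm

ext : (ℕ → ℕ) → ℕ → ℕ
ext ρ zero    = zero
ext ρ (suc i) = suc (ρ i)

rename : (ℕ → ℕ) → Tm → Tm
rename ρ (var i)   = var (ρ i)
rename ρ H         = H
rename ρ (lam t)   = lam (rename (ext ρ) t)
rename ρ (app t u) = app (rename ρ t) (rename ρ u)

exts : (ℕ → Tm) → ℕ → Tm
exts σ zero    = var zero
exts σ (suc i) = rename suc (σ i)

subst : (ℕ → Tm) → Tm → Tm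
subst σ (var i)   = σ i
subst σ H         = H
subst σ (lam t)   = lam (subst (exts σ) t)
subst σ (app t u) = app (subst σ t) (subst σ u)

sub0 : Tm → ℕ → Tm
sub0 B zero    = B
sub0 B (suc i) = var i

_[_] : Tm → Tm → Tm
A [ B ] = subst (sub0 B) A

-- U[J/H] : replace every occurrence of H by a CLOSED term J
-- (no shifting needed under binders since J is closed).
_[_/H] : Tm → Tm → Tm
var i   [ J /H] = var i
H       [ J /H] = J
lam t   [ J /H] = lam (t [ J /H])
app t u [ J /H] = app (t [ J /H]) (u [ J /H])

-- Head reduction  λx̄ ((λx A) B) W1…Wn →t λx̄ A[B/x] W1…Wn
data HeadAppStep : Tm → Tm → Set where
  β    : ∀ {A B} → HeadAppStep (app (lam A) B) (A [ B ])
  appL : ∀ {M M' W} → HeadAppStep M M' → HeadAppStep (app M W) (app M' W)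

data HeadStep : Tm → Tm → Set where
  top : ∀ {M M'} → HeadAppStep M M' → HeadStep M M'
  lam : ∀ {M M'} → HeadStep M M' → HeadStep (lam M) (lam M')

-- J-reduction
--  λx̄ H U1 U2 U3…Un →J λx̄ U1 (H U2) U3…Un   (n ≥ 2)
--  λx̄ H U1          →J λx̄ U1
data JAppStep : Tm → Tm → Set where
  jbase : ∀ {U₁ U₂} → JAppStep (app (app H U₁) U₂) (app U₁ (app H U₂))
  appL  : ∀ {M M' W} → JAppStep M M' → JAppStep (app M W) (app M' W)

data JStep : Tm → Tm → Set where
  top  : ∀ {M M'} → JAppStep M M' → JStep M M'
  one  : ∀ {U₁} → JStep (app H U₁) U₁
  lam  : ∀ {M M'} → JStep M M' → JStep (lam M) (lam M')

-- Head normal forms: λx̄ H  or  λx̄ x V1…Vn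
data VarHead : Tm → Set where
  var : ∀ i → VarHead (var i)
  app : ∀ {M V} → VarHead M → VarHead (app M V)

data HNF : Tm → Set where
  H   : HNF H
  var : ∀ {M} → VarHead M → HNF M
  lam : ∀ {M} → HNF M → HNF (lam M)

JtStep : Tm → Tm → Set
JtStep M N = JStep M N ⊎ HeadStep M N

JtSolvable : Tm → Set
JtSolvable U = Σ Tm λ N → Star JtStep U N × HNF N

-- a λ-term is solvable iff its head reduction terminates
-- (head reduction is deterministic: it reaches a term with no head step)
Solvable : Tm → Set
Solvable M = Σ Tm λ N → Star HeadStep M N × (∀ N' → ¬ HeadStep N N')

-- Y = (λa λf f (a a f)) (λa λf f (a a f))
Θ₀ : Tm
Θ₀ = lam (lam (app (var 0) (app (app (var 1) (var 1)) (var 0))))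

Y : Tm
Y = app Θ₀ Θ₀

-- G = λx λy λz y (x z)
G : Tm
G = lam (lam (lam (app (var 1) (app (var 2) (var 0)))))

J : Tm
J = app Y G

-- J X W head-reduces to X (J W), so J simulates the J-reduction of H step by step, and every
-- t-step of U is a head step of U[J/H].  Conversely, if U[J/H] head-normalises, classify U: a
-- head normal form is already reached, and otherwise U has a J- or t-step to some U′ for which
-- U[J/H] head-reduces in at least one step to U′[J/H] (or, for U = H W, to λz. W[J/H] (J z),
-- which halts only if W[J/H] does), so induction on the number of head steps applies.  The
-- auxiliary fact is that J z W₁ … Wₙ itself head-normalises: substituting variables or J z for
-- variables preserves halting of head reduction.
module Submission where

open import Data.Empty using (⊥-elim)
open import Data.Nat using (ℕ; zero; suc)
open import Data.Product using (∃; ∃-syntax; _×_; _,_; proj₂)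
open import Data.Sum using (_⊎_; inj₁; inj₂)
open import Function.Base using (_∘_)
open import Function.Bundles using (_⇔_; mk⇔; Equivalence)
open import Relation.Nullary using (¬_)
open import Relation.Binary.PropositionalEquality as ≡
  using (_≡_; refl; cong; cong₂; sym; trans)
open import Relation.Binary.Construct.Closure.ReflexiveTransitive using (Star; ε; _◅_; gmap)

open import Defs

private
  variable
    n : ℕ
    M M′ M″ N U U′ X : Tm
    σ : ℕ → Tm

-- Substitution algebra

ext-cong : ∀ {ρ ρ′ : ℕ → ℕ} → (∀ i → ρ i ≡ ρ′ i) → ∀ i → ext ρ i ≡ ext ρ′ i
ext-cong e zero    = refl
ext-cong e (suc i) = cong suc (e i)

rename-cong : ∀ {ρ ρ′} → (∀ i → ρ i ≡ ρ′ i) → ∀ M → rename ρ M ≡ rename ρ′ M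
rename-cong e (var i)   = cong var (e i)
rename-cong e H         = refl
rename-cong e (lam M)   = cong lam (rename-cong (ext-cong e) M)
rename-cong e (app M N) = cong₂ app (rename-cong e M) (rename-cong e N)

exts-cong : ∀ {σ σ′ : ℕ → Tm} → (∀ i → σ i ≡ σ′ i) → ∀ i → exts σ i ≡ exts σ′ i
exts-cong e zero    = refl
exts-cong e (suc i) = cong (rename suc) (e i)

subst-cong : ∀ {σ σ′} → (∀ i → σ i ≡ σ′ i) → ∀ M → subst σ M ≡ subst σ′ M
subst-cong e (var i)   = e i
subst-cong e H         = refl
subst-cong e (lam M)   = cong lam (subst-cong (exts-cong e) M)
subst-cong e (app M N) = cong₂ app (subst-cong e M) (subst-cong e N)

rename-∘ : ∀ ρ ρ′ M → rename ρ (rename ρ′ M) ≡ rename (ρ ∘ ρ′) M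
rename-∘ ρ ρ′ (var i)   = refl
rename-∘ ρ ρ′ H         = refl
rename-∘ ρ ρ′ (lam M)   = cong lam (trans (rename-∘ (ext ρ) (ext ρ′) M) (rename-cong e M))
  where
  e : ∀ i → ext ρ (ext ρ′ i) ≡ ext (ρ ∘ ρ′) i
  e zero    = refl
  e (suc i) = refl
rename-∘ ρ ρ′ (app M N) = cong₂ app (rename-∘ ρ ρ′ M) (rename-∘ ρ ρ′ N)

subst-rename : ∀ σ ρ M → subst σ (rename ρ M) ≡ subst (σ ∘ ρ) M
subst-rename σ ρ (var i)   = refl
subst-rename σ ρ H         = refl
subst-rename σ ρ (lam M)   = cong lam (trans (subst-rename (exts σ) (ext ρ) M) (subst-cong e M))
  where
  e : ∀ i → exts σ (ext ρ i) ≡ exts (σ ∘ ρ) i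
  e zero    = refl
  e (suc i) = refl
subst-rename σ ρ (app M N) = cong₂ app (subst-rename σ ρ M) (subst-rename σ ρ N)

rename-subst : ∀ ρ σ M → rename ρ (subst σ M) ≡ subst (rename ρ ∘ σ) M
rename-subst ρ σ (var i)   = refl
rename-subst ρ σ H         = refl
rename-subst ρ σ (lam M)   = cong lam (trans (rename-subst (ext ρ) (exts σ) M) (subst-cong e M))
  where
  e : ∀ i → rename (ext ρ) (exts σ i) ≡ exts (rename ρ ∘ σ) i
  e zero    = refl
  e (suc i) = trans (rename-∘ (ext ρ) suc (σ i)) (sym (rename-∘ suc ρ (σ i)))
rename-subst ρ σ (app M N) = cong₂ app (rename-subst ρ σ M) (rename-subst ρ σ N)

subst-subst : ∀ τ σ M → subst τ (subst σ M) ≡ subst (subst τ ∘ σ) M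
subst-subst τ σ (var i)   = refl
subst-subst τ σ H         = refl
subst-subst τ σ (lam M)   = cong lam (trans (subst-subst (exts τ) (exts σ) M) (subst-cong e M))
  where
  e : ∀ i → subst (exts τ) (exts σ i) ≡ exts (subst τ ∘ σ) i
  e zero    = refl
  e (suc i) = trans (subst-rename (exts τ) suc (σ i)) (sym (rename-subst suc τ (σ i)))
subst-subst τ σ (app M N) = cong₂ app (subst-subst τ σ M) (subst-subst τ σ N)

subst-var : ∀ M → subst var M ≡ M
subst-var (var i)   = refl
subst-var H         = refl
subst-var (lam M)   = cong lam (trans (subst-cong e M) (subst-var M))
  where
  e : ∀ i → exts var i ≡ var i
  e zero    = refl
  e (suc i) = refl
subst-var (app M N) = cong₂ app (subst-var M) (subst-var N)

rename-as-subst : ∀ ρ M → rename ρ M ≡ subst (var ∘ ρ) M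
rename-as-subst ρ (var i)   = refl
rename-as-subst ρ H         = refl
rename-as-subst ρ (lam M)   = cong lam (trans (rename-as-subst (ext ρ) M) (subst-cong e M))
  where
  e : ∀ i → var (ext ρ i) ≡ exts (var ∘ ρ) i
  e zero    = refl
  e (suc i) = refl
rename-as-subst ρ (app M N) = cong₂ app (rename-as-subst ρ M) (rename-as-subst ρ N)

rename-suc-[] : ∀ X B → rename suc X [ B ] ≡ X
rename-suc-[] X B = trans (subst-rename (sub0 B) suc X) (subst-var X)

subst-[] : ∀ σ A B → subst σ (A [ B ]) ≡ subst (exts σ) A [ subst σ B ]
subst-[] σ A B =
  trans (subst-subst σ (sub0 B) A)
        (trans (subst-cong e A) (sym (subst-subst (sub0 (subst σ B)) (exts σ) A)))
  where
  e : ∀ i → subst σ (sub0 B i) ≡ subst (sub0 (subst σ B)) (exts σ i)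
  e zero    = refl
  e (suc i) = sym (rename-suc-[] (σ i) (subst σ B))

-- Replacing H by a closed term

Closed : Tm → Set
Closed K = ∀ σ → subst σ K ≡ K

module _ {K : Tm} (K-closed : Closed K) where

  [/H]-rename : ∀ ρ A → rename ρ A [ K /H] ≡ rename ρ (A [ K /H])
  [/H]-rename ρ (var i)   = refl
  [/H]-rename ρ H         = sym (trans (rename-as-subst ρ K) (K-closed _))
  [/H]-rename ρ (lam A)   = cong lam ([/H]-rename (ext ρ) A)
  [/H]-rename ρ (app A B) = cong₂ app ([/H]-rename ρ A) ([/H]-rename ρ B)

  [/H]-subst : ∀ σ A → subst σ A [ K /H] ≡ subst (λ i → σ i [ K /H]) (A [ K /H])
  [/H]-subst σ (var i)   = refl
  [/H]-subst σ H         = sym (K-closed _)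
  [/H]-subst σ (lam A)   =
    cong lam (trans ([/H]-subst (exts σ) A) (subst-cong e (A [ K /H])))
    where
    e : ∀ i → exts σ i [ K /H] ≡ exts (λ i → σ i [ K /H]) i
    e zero    = refl
    e (suc i) = [/H]-rename suc (σ i)
  [/H]-subst σ (app A B) = cong₂ app ([/H]-subst σ A) ([/H]-subst σ B)

  [/H]-[] : ∀ A B → A [ B ] [ K /H] ≡ A [ K /H] [ B [ K /H] ]
  [/H]-[] A B = trans ([/H]-subst (sub0 B) A) (subst-cong e (A [ K /H]))
    where
    e : ∀ i → sub0 B i [ K /H] ≡ sub0 (B [ K /H]) i
    e zero    = refl
    e (suc i) = refl

  HeadAppStep-[/H] : HeadAppStep M M′ → HeadAppStep (M [ K /H]) (M′ [ K /H])
  HeadAppStep-[/H] (β {A} {B}) = ≡.subst (HeadAppStep _) (sym ([/H]-[] A B)) β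
  HeadAppStep-[/H] (appL s)    = appL (HeadAppStep-[/H] s)

  HeadStep-[/H] : HeadStep M M′ → HeadStep (M [ K /H]) (M′ [ K /H])
  HeadStep-[/H] (top s) = top (HeadAppStep-[/H] s)
  HeadStep-[/H] (lam s) = lam (HeadStep-[/H] s)

-- Head reduction, with H as an inert constant

data Neutral : Tm → Set where
  var : ∀ i → Neutral (var i)
  H   : Neutral H
  app : Neutral M → Neutral (app M X)

data HeadNormal : Tm → Set where
  ne  : Neutral M → HeadNormal M
  lam : HeadNormal M → HeadNormal (lam M)

VarHead⇒Neutral : ∀ {K} → VarHead M → Neutral (M [ K /H])
VarHead⇒Neutral (var i) = var i
VarHead⇒Neutral (app v) = app (VarHead⇒Neutral v)

Neutral-irreducible : Neutral M → ¬ HeadAppStep M M′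
Neutral-irreducible (app ()) β
Neutral-irreducible (app v) (appL s) = Neutral-irreducible v s

HeadNormal-irreducible : HeadNormal M → ¬ HeadStep M M′
HeadNormal-irreducible (ne v)  (top s) = Neutral-irreducible v s
HeadNormal-irreducible (lam h) (lam s) = HeadNormal-irreducible h s

data AppView : Tm → Set where
  redex       : HeadAppStep M M′ → AppView M
  neutral     : Neutral M → AppView M
  abstraction : ∀ A → AppView (lam A)

appView : ∀ M → AppView M
appView (var i)   = neutral (var i)
appView H         = neutral H
appView (lam A)   = abstraction A
appView (app M X) with appView M
... | redex s       = redex (appL s)
... | neutral v     = neutral (app v)
... | abstraction A = redex β

headProgress : ∀ M → (∃ λ M′ → HeadStep M M′) ⊎ HeadNormal M
headProgress M with appView M
... | redex s       = inj₁ (_ , top s)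
... | neutral v     = inj₂ (ne v)
... | abstraction A with headProgress A
...   | inj₁ (_ , s) = inj₁ (_ , lam s)
...   | inj₂ h       = inj₂ (lam h)

HeadAppStep-deterministic : HeadAppStep M M′ → HeadAppStep M M″ → M′ ≡ M″
HeadAppStep-deterministic β        β        = refl
HeadAppStep-deterministic (appL s) (appL t) = cong (λ F → app F _) (HeadAppStep-deterministic s t)

HeadStep-deterministic : HeadStep M M′ → HeadStep M M″ → M′ ≡ M″
HeadStep-deterministic (top s) (top t) = HeadAppStep-deterministic s t
HeadStep-deterministic (lam s) (lam t) = cong lam (HeadStep-deterministic s t)

appL⋆ : Star HeadAppStep M M′ → Star HeadAppStep (app M X) (app M′ X)
appL⋆ = gmap (λ M → app M _) appL

top⋆ : Star HeadAppStep M M′ → Star HeadStep M M′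
top⋆ = gmap (λ M → M) top

HeadAppStep-subst : ∀ σ → HeadAppStep M M′ → HeadAppStep (subst σ M) (subst σ M′)
HeadAppStep-subst σ (β {A} {B}) = ≡.subst (HeadAppStep _) (sym (subst-[] σ A B)) β
HeadAppStep-subst σ (appL s)    = appL (HeadAppStep-subst σ s)

HeadStep-subst : ∀ σ → HeadStep M M′ → HeadStep (subst σ M) (subst σ M′)
HeadStep-subst σ (top s) = top (HeadAppStep-subst σ s)
HeadStep-subst σ (lam s) = lam (HeadStep-subst (exts σ) s)

data HaltsWithin : ℕ → Tm → Set where
  done : HeadNormal M → HaltsWithin n M
  step : HeadStep M M′ → HaltsWithin n M′ → HaltsWithin (suc n) M

Halts : Tm → Set
Halts M = ∃[ n ] HaltsWithin n M

HaltsWithin-suc : HaltsWithin n M → HaltsWithin (suc n) M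
HaltsWithin-suc (done h)   = done h
HaltsWithin-suc (step s h) = step s (HaltsWithin-suc h)

HaltsWithin-zero-irreducible : HaltsWithin 0 M → ¬ HeadStep M M′
HaltsWithin-zero-irreducible (done h) = HeadNormal-irreducible h

HaltsWithin-step⁻¹ : HaltsWithin (suc n) M → HeadStep M M′ → HaltsWithin n M′
HaltsWithin-step⁻¹ (done h)   t = ⊥-elim (HeadNormal-irreducible h t)
HaltsWithin-step⁻¹ (step s h) t rewrite HeadStep-deterministic t s = h

HaltsWithin-steps⁻¹ : HaltsWithin n M → Star HeadStep M M′ → HaltsWithin n M′
HaltsWithin-steps⁻¹         h ε        = h
HaltsWithin-steps⁻¹ {zero}  h (s ◅ ss) = ⊥-elim (HaltsWithin-zero-irreducible h s)
HaltsWithin-steps⁻¹ {suc n} h (s ◅ ss) =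
  HaltsWithin-steps⁻¹ (HaltsWithin-suc (HaltsWithin-step⁻¹ h s)) ss

HaltsWithin-steps⁺⁻¹ : HaltsWithin (suc n) M → HeadStep M M′ → Star HeadStep M′ M″ →
                       HaltsWithin n M″
HaltsWithin-steps⁺⁻¹ h s ss = HaltsWithin-steps⁻¹ (HaltsWithin-step⁻¹ h s) ss

Halts-expand : Star HeadStep M M′ → Halts M′ → Halts M
Halts-expand ε        h = h
Halts-expand (s ◅ ss) h with Halts-expand ss h
... | n , h′ = suc n , step s h′

HaltsWithin-lam : HaltsWithin n M → HaltsWithin n (lam M)
HaltsWithin-lam (done h)   = done (lam h)
HaltsWithin-lam (step s h) = step (lam s) (HaltsWithin-lam h)

Halts-lam : Halts M → Halts (lam M)
Halts-lam (n , h) = n , HaltsWithin-lam h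

HaltsWithin-lam⁻¹ : HaltsWithin n (lam M) → HaltsWithin n M
HaltsWithin-lam⁻¹ (done (lam h))   = done h
HaltsWithin-lam⁻¹ (step (lam s) h) = step s (HaltsWithin-lam⁻¹ h)

HaltsWithin-subst⁻¹ : ∀ n σ M → HaltsWithin n (subst σ M) → HaltsWithin n M
HaltsWithin-subst⁻¹ n σ M h with headProgress M
... | inj₂ nf = done nf
HaltsWithin-subst⁻¹ zero    σ M h | inj₁ (_ , s) =
  ⊥-elim (HaltsWithin-zero-irreducible h (HeadStep-subst σ s))
HaltsWithin-subst⁻¹ (suc n) σ M h | inj₁ (M′ , s) =
  step s (HaltsWithin-subst⁻¹ n σ M′ (HaltsWithin-step⁻¹ h (HeadStep-subst σ s)))

HaltsWithin-rename-suc⁻¹ : HaltsWithin n (rename suc M) → HaltsWithin n M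
HaltsWithin-rename-suc⁻¹ {n} {M} h rewrite rename-as-subst suc M = HaltsWithin-subst⁻¹ n _ M h

HaltsWithin-app⁻¹ : HaltsWithin n (app M X) → HaltsWithin n M
HaltsWithin-app⁻¹ (done (ne (app v)))     = done (ne v)
HaltsWithin-app⁻¹ (step (top (appL s)) h) = step (top s) (HaltsWithin-app⁻¹ h)
HaltsWithin-app⁻¹ {suc n} {lam A} {X} (step (top β) h) =
  HaltsWithin-suc (HaltsWithin-lam (HaltsWithin-subst⁻¹ n (sub0 X) A h))

Solvable⇔Halts : Solvable M ⇔ Halts M
Solvable⇔Halts = mk⇔ to from
  where
  to : Solvable M → Halts M
  to (N , M↠N , irreducible) with headProgress N
  ... | inj₁ (N′ , s) = ⊥-elim (irreducible N′ s)
  ... | inj₂ h        = Halts-expand M↠N (0 , done h)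

  from′ : HaltsWithin n M → Solvable M
  from′ (done h)   = _ , ε , λ _ → HeadNormal-irreducible h
  from′ (step s h) with from′ h
  ... | N , M′↠N , irreducible = N , s ◅ M′↠N , irreducible

  from : Halts M → Solvable M
  from (_ , h) = from′ h

-- Head reductions of J = Y G

J-closed : Closed J
J-closed σ = refl

Y₁ : Tm
Y₁ = lam (app (var 0) (app Y (var 0)))

Jλ : Tm → Tm
Jλ X = lam (app (rename suc X) (app J (var 0)))

J↠ : Star HeadAppStep J (lam (Jλ (var 0)))
J↠ = appL β ◅ β ◅ β ◅ ε

J·-step : ∀ X → HeadAppStep (app J X) (app (app Y₁ G) X)
J·-step X = appL (appL β)

J·-steps : ∀ X → Star HeadAppStep (app (app Y₁ G) X) (Jλ X)
J·-steps X = appL β ◅ appL β ◅ β ◅ ε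

J·↠ : ∀ X → Star HeadStep (app J X) (Jλ X)
J·↠ X = top⋆ (J·-step X ◅ J·-steps X)

J··-steps : ∀ X W → Star HeadAppStep (app (app (app Y₁ G) X) W) (app X (app J W))
J··-steps X W =
  appL (appL β) ◅ appL (appL β) ◅ appL β ◅
  ≡.subst (HeadAppStep _) (cong (λ F → app F (app J W)) (rename-suc-[] X W)) β ◅ ε

JAppStep-simulated : JAppStep U U′ →
  ∃ λ X → HeadAppStep (U [ J /H]) X × Star HeadAppStep X (U′ [ J /H])
JAppStep-simulated (jbase {U₁} {U₂}) =
  _ , appL (J·-step (U₁ [ J /H])) , J··-steps (U₁ [ J /H]) (U₂ [ J /H])
JAppStep-simulated (appL s) with JAppStep-simulated s
... | _ , first , rest = _ , appL first , appL⋆ rest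

data VarOrJVar : Tm → Set where
  var  : ∀ j → VarOrJVar (var j)
  Jvar : ∀ j → VarOrJVar (app J (var j))

JVarSubst : (ℕ → Tm) → Set
JVarSubst σ = ∀ i → VarOrJVar (σ i)

VarOrJVar-rename-suc : VarOrJVar M → VarOrJVar (rename suc M)
VarOrJVar-rename-suc (var j)  = var (suc j)
VarOrJVar-rename-suc (Jvar j) = Jvar (suc j)

JVarSubst-exts : JVarSubst σ → JVarSubst (exts σ)
JVarSubst-exts c zero    = var 0
JVarSubst-exts c (suc i) = VarOrJVar-rename-suc (c i)

JVarSubst-sub0 : ∀ z → JVarSubst (sub0 (app J (var z)))
JVarSubst-sub0 z zero    = Jvar z
JVarSubst-sub0 z (suc i) = var i

VarOrJVar-neutral : VarOrJVar M → Neutral M ⊎ ∃ λ j → M ≡ app J (var j)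
VarOrJVar-neutral (var j)  = inj₁ (var j)
VarOrJVar-neutral (Jvar j) = inj₂ (j , refl)

-- J x V₁ … Vₙ with n ≥ 1 head-reduces to the neutral term x (J V₁) V₂ … Vₙ.
Neutral-JVarSubst : JVarSubst σ → Neutral M →
  (∃ λ N → Star HeadAppStep (subst σ M) N × Neutral N) ⊎ (∃ λ j → subst σ M ≡ app J (var j))
Neutral-JVarSubst {σ} c (var i) with VarOrJVar-neutral (c i)
... | inj₁ v   = inj₁ (σ i , ε , v)
... | inj₂ isJ = inj₂ isJ
Neutral-JVarSubst c H = inj₁ (H , ε , H)
Neutral-JVarSubst {σ} {app M V} c (app v) with subst σ M | Neutral-JVarSubst c v
... | _ | inj₁ (N , ss , v′) = inj₁ (app N (subst σ V) , appL⋆ ss , app v′)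
... | _ | inj₂ (j , refl)    =
  inj₁ (_ , appL (J·-step (var j)) ◅ J··-steps (var j) (subst σ V) , app (var j))

HeadNormal-JVarSubst : JVarSubst σ → HeadNormal M → Halts (subst σ M)
HeadNormal-JVarSubst c (lam h) = Halts-lam (HeadNormal-JVarSubst (JVarSubst-exts c) h)
HeadNormal-JVarSubst c (ne v) with Neutral-JVarSubst c v
... | inj₁ (N , ss , v′) = Halts-expand (top⋆ ss) (0 , done (ne v′))
... | inj₂ (j , eq) rewrite eq = Halts-expand (J·↠ (var j)) (0 , done (lam (ne (app (var (suc j))))))

HaltsWithin-JVarSubst : JVarSubst σ → HaltsWithin n M → Halts (subst σ M)
HaltsWithin-JVarSubst c (done h)   = HeadNormal-JVarSubst c h
HaltsWithin-JVarSubst c (step s h) = Halts-expand (HeadStep-subst _ s ◅ ε) (HaltsWithin-JVarSubst c h)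

Halts-app-JVar : ∀ z → HaltsWithin n M → Halts (app M (app J (var z)))
Halts-app-JVar {M = lam A} z h =
  Halts-expand (top β ◅ ε) (HaltsWithin-JVarSubst (JVarSubst-sub0 z) (HaltsWithin-lam⁻¹ h))
Halts-app-JVar z (done (ne v))    = 0 , done (ne (app v))
Halts-app-JVar z (step (top s) h)    = Halts-expand (top (appL s) ◅ ε) (Halts-app-JVar z h)

Halts-Jλ : HaltsWithin n M → Halts (Jλ M)
Halts-Jλ {M = M} h with HaltsWithin-JVarSubst {σ = λ i → var (suc i)} (λ i → var (suc i)) h
... | _ , h′ = Halts-lam (Halts-app-JVar 0 (≡.subst (HaltsWithin _) (sym (rename-as-subst suc M)) h′))

-- Soundness

HNF-[J/H]-halts : HNF N → Halts (N [ J /H])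
HNF-[J/H]-halts H       = Halts-expand (top⋆ J↠) (0 , done (lam (lam (ne (app (var 1))))))
HNF-[J/H]-halts (var v) = 0 , done (ne (VarHead⇒Neutral v))
HNF-[J/H]-halts (lam h) = Halts-lam (HNF-[J/H]-halts h)

JStep-[J/H]-expand : JStep U U′ → Halts (U′ [ J /H]) → Halts (U [ J /H])
JStep-[J/H]-expand (top s) h with JAppStep-simulated s
... | _ , first , rest = Halts-expand (top⋆ (first ◅ rest)) h
JStep-[J/H]-expand (one {W}) (_ , h) = Halts-expand (J·↠ (W [ J /H])) (Halts-Jλ h)
JStep-[J/H]-expand (lam s) (_ , h) = Halts-lam (JStep-[J/H]-expand s (_ , HaltsWithin-lam⁻¹ h))

JtStep-[J/H]-expand : JtStep U U′ → Halts (U′ [ J /H]) → Halts (U [ J /H])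
JtStep-[J/H]-expand (inj₁ s) = JStep-[J/H]-expand s
JtStep-[J/H]-expand (inj₂ s) = Halts-expand (HeadStep-[/H] J-closed s ◅ ε)

JtSolvable⇒Halts : JtSolvable U → Halts (U [ J /H])
JtSolvable⇒Halts (_ , ε        , h) = HNF-[J/H]-halts h
JtSolvable⇒Halts (_ , s ◅ U′↠N , h) = JtStep-[J/H]-expand s (JtSolvable⇒Halts (_ , U′↠N , h))

-- Completeness

data JtView : Tm → Set where
  varHead     : VarHead U → JtView U
  constH      : JtView H
  H-applied   : ∀ W → JtView (app H W)
  t-redex     : HeadAppStep U U′ → JtView U
  J-redex     : JAppStep U U′ → JtView U
  abstraction : ∀ A → JtView (lam A)

jtView : ∀ U → JtView U
jtView (var i)   = varHead (var i)
jtView H         = constH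
jtView (lam A)   = abstraction A
jtView (app M V) with jtView M
... | varHead v     = varHead (app v)
... | constH        = H-applied V
... | H-applied W   = J-redex jbase
... | t-redex s     = t-redex (appL s)
... | J-redex s     = J-redex (appL s)
... | abstraction A = t-redex β

JtSolvable-lam : JtSolvable U → JtSolvable (lam U)
JtSolvable-lam (N , U↠N , h) = lam N , gmap lam under-lam U↠N , lam h
  where
  under-lam : JtStep M M′ → JtStep (lam M) (lam M′)
  under-lam (inj₁ s) = inj₁ (lam s)
  under-lam (inj₂ s) = inj₂ (lam s)

JtSolvable-expand : JtStep U U′ → JtSolvable U′ → JtSolvable U
JtSolvable-expand s (N , U′↠N , h) = N , s ◅ U′↠N , h

HaltsWithin⇒JtSolvable : ∀ n U → HaltsWithin n (U [ J /H]) → JtSolvable U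
HaltsWithin⇒JtSolvable n U h with jtView U
... | varHead v     = U , ε , var v
... | constH        = H , ε , H
... | abstraction A = JtSolvable-lam (HaltsWithin⇒JtSolvable n A (HaltsWithin-lam⁻¹ h))
HaltsWithin⇒JtSolvable zero U h | H-applied W =
  ⊥-elim (HaltsWithin-zero-irreducible h (top (J·-step (W [ J /H]))))
HaltsWithin⇒JtSolvable (suc n) U h | H-applied W =
  JtSolvable-expand (inj₁ one) (HaltsWithin⇒JtSolvable n W W-halts)
  where
  W-halts : HaltsWithin n (W [ J /H])
  W-halts = HaltsWithin-rename-suc⁻¹ (HaltsWithin-app⁻¹ (HaltsWithin-lam⁻¹
    (HaltsWithin-steps⁺⁻¹ h (top (J·-step (W [ J /H]))) (top⋆ (J·-steps (W [ J /H]))))))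
HaltsWithin⇒JtSolvable zero U h | t-redex s =
  ⊥-elim (HaltsWithin-zero-irreducible h (top (HeadAppStep-[/H] J-closed s)))
HaltsWithin⇒JtSolvable (suc n) U h | t-redex s =
  JtSolvable-expand (inj₂ (top s))
    (HaltsWithin⇒JtSolvable n _ (HaltsWithin-step⁻¹ h (top (HeadAppStep-[/H] J-closed s))))
HaltsWithin⇒JtSolvable n U h | J-redex s with JAppStep-simulated s
HaltsWithin⇒JtSolvable zero U h | J-redex s | _ , first , rest =
  ⊥-elim (HaltsWithin-zero-irreducible h (top first))
HaltsWithin⇒JtSolvable (suc n) U h | J-redex s | _ , first , rest =
  JtSolvable-expand (inj₁ (top s))
    (HaltsWithin⇒JtSolvable n _ (HaltsWithin-steps⁺⁻¹ h (top first) (top⋆ rest)))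

lemma3p13 : (U : Tm) → JtSolvable U ⇔ Solvable (U [ J /H])
lemma3p13 U = mk⇔ (from Solvable⇔Halts ∘ JtSolvable⇒Halts)
                  (λ s → HaltsWithin⇒JtSolvable _ U (proj₂ (to Solvable⇔Halts s)))
  where open Equivalence
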